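{- Let $\{\mathcal B_n\}_{n\in\omega}$ be an entwined family of structures and, for $n\ge 1$, let $\mathcal H_n := \mathcal E(\mathcal B_{n-1})_n$ be the entwined order-$n$ frame derived from $\mathcal B_{n-1}$. Let $\sigma$ be an initial type and $n\ge1$. If $n>\mathrm{order}(\sigma)$, or $n=\mathrm{order}(\sigma)$ and $\sigma$ is an inactive type, then $\mathcal H_n[\![\sigma]\!]$ is a finite set.
   Context: Setting: a first-order $\Sigma_{\mathrm{bg}}$-structure $\mathcal A$ with sorts $S$ and $W$, where $\mathcal A[S]$ is finite and $\le^{\mathcal A}$ is a total order on $\mathcal A[W]$; a finite foreground signature $\Sigma_{\mathrm{fg}}$ of predicate symbols of initial types. Types: $\sigma ::= S\mid W\mid\rho$, $\rho::= o\mid\sigma\to\rho$; $\mathrm{order}(S)=\mathrm{order}(W)=\mathrm{order}(o)=0$, $\mathrm{order}(\sigma_1\to\sigma_2)=\max(\mathrm{order}(\sigma_1)+1,\mathrm{order}(\sigma_2))$. A relational type $\sigma_1\to\cdots\to\sigma_n\to o$ is initial if at most one $\sigma_i$ is $W$; if $\sigma_j=W$ then $\mathrm{order}(\sigma_i)<\mathrm{order}(\sigma_j\to\cdots\to\sigma_n\to o)$ for all $i<j$; and each $\sigma_j$ is $S$, $W$ or initial. An initial type is active if some $\sigma_i$ is $W$, otherwise inactive. A frame $\mathcal H$ assigns to each type a set with $\mathcal H[\![S]\!]=\mathcal A[S]$, $\mathcal H[\![W]\!]=\mathcal A[W]$, $\mathcal H[\![o]\!]=\{0,1\}$, and $\mathcal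 H[\![\sigma_1\to\sigma_2]\!]$ a set of functions from $\mathcal H[\![\sigma_1]\!]$ to $\mathcal H[\![\sigma_2]\!]$; the standard frame $\mathcal S$ takes all such functions. For $\Xi\subseteq\Sigma_{\mathrm{fg}}$, a $(\Xi,\mathcal H)$-structure $\mathcal B$ expands $\mathcal A$ by assigning to each $X:\rho\in\Xi$ an element $X^{\mathcal B}\in\mathcal H[\![\rho]\!]$; a $(\Xi_2,\mathcal H_2)$-structure is an expansion of a $(\Xi_1,\mathcal H_1)$-structure ($\Xi_1\subseteq\Xi_2$) if they agree on $\Xi_1$. On relational function spaces define $f\le_o g$ for $\mathbb B=\{0,1\}$ by ($f=0$ or $g=1$), and pointwise at higher arity; $\top$ is the constantly-$1$ function. Entwined order-$n$ frame $\mathcal E(\mathcal B)_n$ ($n\ge1$, $\mathcal B$ a $(\Xi,\mathcal H)$-structure): (i) if $\sigma$ is initial with $\mathrm{order}(\sigma)\le n-2$, or $\sigma$ is inactive, $S$, $W$ or $o$ with $\mathrm{order}(\sigma)\le n-1$: $\mathcal E(\mathcal B)_n[\![\sigma]\!]=\mathcal H[\![\sigma]\!]$. (ii) if $\sigma$ is active of order $n-1$: $\mathcal E(\mathcal B)_n[\![W\to\nu]\!]=\{\top\}\cup\{X^{\mathcal B}\,\overline s\mid X:\overline\tau\to W\to\nu\in\Xi,\ s_i\in\mathcal H[\![\tau_i]\!]\}$ and $\mathcal E(\mathcal B)_n[\![\sigma_1\to\xi]\!]$ is the set of all functions $\mathcal E(\mathcal B)_n[\![\sigma_1]\!]\to\mathcal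 E(\mathcal B)_n[\![\xi]\!]$. (iii) if $\sigma$ is initial of order $n$: $\mathcal E(\mathcal B)_n[\![W\to\nu]\!]$ is the set of $f:\mathcal A[W]\to\mathcal E(\mathcal B)_n[\![\nu]\!]$ with $f(z)\le_o f(z')$ whenever $z\le^{\mathcal A}z'$, and for $\sigma_1\ne W$, $\mathcal E(\mathcal B)_n[\![\sigma_1\to\sigma_2]\!]$ is all functions $\mathcal E(\mathcal B)_n[\![\sigma_1]\!]\to\mathcal E(\mathcal B)_n[\![\sigma_2]\!]$. (iv) otherwise (non-initial or order $>n$): all functions $\mathcal E(\mathcal B)_n[\![\sigma_1]\!]\to\mathcal E(\mathcal B)_n[\![\sigma_2]\!]$. Let $\Sigma_i\subseteq\Sigma_{\mathrm{fg}}$ be the symbols of type order at most $i$. A family $\{\mathcal B_n\}_{n\in\omega}$ is entwined if $\mathcal B_0$ is the unique $(\emptyset,\mathcal S)$-structure and each $\mathcal B_{n+1}$ is a $(\Sigma_{n+1},\mathcal E(\mathcal B_n)_{n+1})$-expansion of $\mathcal B_n$. -}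

module Defs where

open import Data.Nat using (ℕ; zero; suc; _≤_; _⊔_; _≤ᵇ_; _≡ᵇ_; pred)
open import Data.Nat.Properties using (_≤?_; ≤-antisym; ≰⇒>)
open import Data.Bool using (Bool; true; false; _∧_; _∨_; not; T; if_then_else_)
open import Data.List using (List; []; _∷_; foldr)
open import Data.Fin using (Fin)
open import Data.Product using (Σ; _×_; _,_; proj₁; proj₂; Σ-syntax; ∃-syntax)
open import Data.Sum using (_⊎_)
open import Data.Unit using (⊤; tt)
open import Data.Empty using (⊥)
open import Relation.Binary.PropositionalEquality using (_≡_; subst)
open import Relation.Binary.Structures using (IsTotalOrder)
open import Relation.Nullary using (Dec; yes; no)

-- Types  σ ::= S | W | ρ ,  ρ ::= o | σ → ρ
-- (raw syntax; well-formedness is part of `Initial`)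

infixr 5 _⇒_
data Ty : Set where
  S W o : Ty
  _⇒_ : Ty → Ty → Ty

order : Ty → ℕ
order S = 0
order W = 0
order o = 0
order (a ⇒ r) = suc (order a) ⊔ order r

allB : List ℕ → (ℕ → Bool) → Bool
allB [] p = true
allB (x ∷ xs) p = p x ∧ allB xs p

isW : Ty → Bool
isW W = true
isW _ = false

-- ini ps w σ : σ (the remaining part σ_j → ⋯ → σ_n → o of a relational type)
-- is initial, where ps are the orders of the preceding arguments σ_i (i < j)
-- and w records whether a W argument has already occurred.
mutual
  argOK : Ty → Bool
  argOK S = true
  argOK W = true
  argOK o = ini [] false o
  argOK (a ⇒ r) = ini [] false (a ⇒ r)

  ini : List ℕ → Bool → Ty → Bool
  ini ps w o = true
  ini ps w (a ⇒ r) =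
    argOK a
    ∧ (if isW a
       then not w ∧ allB ps (λ p → suc p ≤ᵇ order (a ⇒ r))
       else true)
    ∧ ini (order a ∷ ps) (w ∨ isW a) r
  ini ps w S = false
  ini ps w W = false

initial : Ty → Bool
initial σ = ini [] false σ

Initial : Ty → Set
Initial σ = T (initial σ)

active : Ty → Bool
active (a ⇒ r) = isW a ∨ active r
active _ = false

Inactive : Ty → Set
Inactive σ = T (not (active σ))

-- the four cases of the entwined order-n frame, for n = suc m
data Case : Set where
  case-i case-ii case-iii case-iv : Case

classify : ℕ → Ty → Case
classify m σ =
  if (initial σ ∧ (suc (order σ) ≤ᵇ m))
     ∨ (((isW σ ∨ (initial σ ∧ not (active σ))) ∧ (order σ ≤ᵇ m)) ∨ isS σ)
  then case-i
  else if initial σ ∧ active σ ∧ (order σ ≡ᵇ m)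
  then case-ii
  else if initial σ ∧ (order σ ≡ᵇ suc m)
  then case-iii
  else case-iv
  where
  isS : Ty → Bool
  isS S = true
  isS _ = false

-- Sets modulo equality (partial equivalence relations)

record PER (A : Set) : Set₁ where
  field
    El : A → Set
    Eq : A → A → Set
open PER public

Fun : {A B : Set} → PER A → PER B → PER (A → B)
El (Fun P Q) f =
  (∀ x → El P x → El Q (f x)) ×
  (∀ x y → El P x → El P y → Eq P x y → Eq Q (f x) (f y))
Eq (Fun P Q) f g = ∀ x → El P x → Eq Q (f x) (g x)

Disc : (A : Set) → PER A
El (Disc A) _ = ⊤
Eq (Disc A) = _≡_

FinitePER : {A : Set} → PER A → Set
FinitePER {A} P =
  ∃[ k ] Σ[ e ∈ (Fin k → A) ]
    ((∀ i → El P (e i)) × (∀ x → El P x → ∃[ i ] Eq P x (e i)))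

record Setting : Set₁ where
  field
    SCar     : Set
    S-finite : ∃[ k ] Σ[ e ∈ (Fin k → SCar) ] (∀ s → ∃[ i ] e i ≡ s)
    WCar     : Set
    _≤W_     : WCar → WCar → Set
    ≤W-total : IsTotalOrder _≡_ _≤W_
    nSym       : ℕ
    ty         : Fin nSym → Ty
    ty-initial : ∀ X → Initial (ty X)

module Construction (𝒜 : Setting) where
  open Setting 𝒜

  Sym : Set
  Sym = Fin nSym

  D : Ty → Set
  D S = SCar
  D W = WCar
  D o = Bool
  D (a ⇒ r) = D a → D r

  Std : (σ : Ty) → PER (D σ)
  Std S = Disc SCar
  Std W = Disc WCar
  Std o = Disc Bool
  Std (a ⇒ r) = Fun (Std a) (Std r)

  -- symbols newly interpreted in B_m (B_0: none; B_1: Σ_1; B_(m+2): order m+2)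
  Fresh : ℕ → ℕ → Set
  Fresh zero k = ⊥
  Fresh (suc zero) k = k ≤ 1
  Fresh (suc (suc m)) k = k ≡ suc (suc m)

  -- symbols interpreted in B_m (B_0 interprets ∅, B_(m+1) interprets Σ_(m+1))
  InΞ : ℕ → ℕ → Set
  InΞ zero k = ⊥
  InΞ (suc m) k = k ≤ suc m

  ArgVals : List Ty → Set
  ArgVals [] = ⊤
  ArgVals (τ ∷ τs) = D τ × ArgVals τs

  AllEl : ((σ : Ty) → PER (D σ)) → (τs : List Ty) → ArgVals τs → Set
  AllEl P [] _ = ⊤
  AllEl P (τ ∷ τs) (x , xs) = El (P τ) x × AllEl P τs xs

  appSp : (τs : List Ty) (U : Ty) → D (foldr _⇒_ U τs) → ArgVals τs → D U
  appSp [] U f _ = f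
  appSp (τ ∷ τs) U f (x , xs) = appSp τs U (f x) xs

  IsTop : ((σ : Ty) → PER (D σ)) → (ρ : Ty) → D ρ → Set
  IsTop P o b = b ≡ true
  IsTop P (a ⇒ r) f = ∀ x → El (P a) x → IsTop P r (f x)
  IsTop P _ _ = ⊥

  mutual
    -- Ent m : the structures B_0, …, B_m of an entwined family
    Ent : ℕ → Set
    Ent zero = ⊤
    Ent (suc m) =
      Σ[ b ∈ Ent m ]
        ((X : Sym) → Fresh (suc m) (order (ty X)) →
           Σ[ v ∈ D (ty X) ] El (F m b (ty X)) v)

    -- the frame H of B_m  (B_0 : standard frame; B_(k+1) : E(B_k)_(k+1))
    prev : (m : ℕ) → Ent m → (σ : Ty) → PER (D σ)
    prev zero _ = Std
    prev (suc k) (b , _) = F k b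

    -- F m b = E(B_m)_(m+1), the entwined order-(m+1) frame of B_m
    F : (m : ℕ) → Ent m → (σ : Ty) → PER (D σ)
    F m b S = Disc SCar
    F m b W = Disc WCar
    F m b o = Disc Bool
    F m b (W ⇒ r) = FW m b r (classify m (W ⇒ r))
    F m b (S ⇒ r) = FArr m b S r (classify m (S ⇒ r))
    F m b (o ⇒ r) = FArr m b o r (classify m (o ⇒ r))
    F m b ((a₁ ⇒ a₂) ⇒ r) = FArr m b (a₁ ⇒ a₂) r (classify m ((a₁ ⇒ a₂) ⇒ r))

    FArr : (m : ℕ) → Ent m → (a r : Ty) → Case → PER (D (a ⇒ r))
    FArr m b a r case-i = prev m b (a ⇒ r)
    FArr m b a r case-ii = Fun (F m b a) (F m b r)
    FArr m b a r case-iii = Fun (F m b a) (F m b r)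
    FArr m b a r case-iv = Fun (F m b a) (F m b r)

    FW : (m : ℕ) → Ent m → (r : Ty) → Case → PER (D (W ⇒ r))
    FW m b r case-i = prev m b (W ⇒ r)
    -- {⊤} ∪ { X^B s̄ | X : τ̄ → W → r ∈ Ξ, s_i ∈ H[τ_i] }
    El (FW m b r case-ii) f =
      (∀ w → El (prev m b r) (f w)) ×
      ((∀ w → IsTop (prev m b) r (f w))
       ⊎ (Σ[ X ∈ Sym ] Σ[ p ∈ InΞ m (order (ty X)) ]
          Σ[ τs ∈ List Ty ] Σ[ eq ∈ ty X ≡ foldr _⇒_ (W ⇒ r) τs ]
          Σ[ s ∈ ArgVals τs ]
            (AllEl (prev m b) τs s ×
             (∀ w → Eq (prev m b r) (f w)
                       (appSp τs (W ⇒ r) (subst D eq (val m b X p)) s w)))))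
    Eq (FW m b r case-ii) f g = ∀ w → Eq (prev m b r) (f w) (g w)
    El (FW m b r case-iii) f =
      (∀ w → El (F m b r) (f w)) ×
      (∀ z z' → z ≤W z' → LeqF m b r (f z) (f z'))
    Eq (FW m b r case-iii) f g = ∀ w → Eq (F m b r) (f w) (g w)
    FW m b r case-iv = Fun (Disc WCar) (F m b r)

    LeqF : (m : ℕ) → Ent m → (ρ : Ty) → D ρ → D ρ → Set
    LeqF m b o x y = x ≡ false ⊎ y ≡ true
    LeqF m b (a ⇒ r) f g = ∀ x → El (F m b a) x → LeqF m b r (f x) (g x)
    LeqF m b _ _ _ = ⊥

    val : (m : ℕ) (b : Ent m) (X : Sym) → InΞ m (order (ty X)) → D (ty X)
    val zero b X ()
    val (suc zero) bn X p = proj₁ (proj₂ bn X p)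
    val (suc (suc m)) bn X p = valStep (suc m) (proj₁ bn) (proj₂ bn) X p (order (ty X) ≤? suc m)

    valStep : (k : ℕ) (b : Ent k)
      (new : (X : Sym) → Fresh (suc k) (order (ty X)) → Σ[ v ∈ D (ty X) ] El (F k b (ty X)) v)
      (X : Sym) → order (ty X) ≤ suc k → Dec (order (ty X) ≤ k) → D (ty X)
    valStep zero b new X p _ = proj₁ (new X p)
    valStep (suc k) b new X p (yes q) = val (suc k) b X q
    valStep (suc k) b new X p (no q) = proj₁ (new X (≤-antisym p (≰⇒> q)))


  record Family : Set where
    field
      B   : (n : ℕ) → Ent n
      coh : ∀ n → proj₁ (B (suc n)) ≡ B n

  H : Family → ℕ → (σ : Ty) → PER (D σ)
  H fam n = F (pred n) (Family.B fam (pred n))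

{-# OPTIONS --safe #-}
-- Clause (i) makes H_(n+1)[σ] equal to H_n[σ] for the
-- types that are already settled at n, so these are finite by induction. An inactive type of
-- order n + 1 (clause (iii)), or an active type a → ν of order n with a ≠ W (clause (ii)),
-- gets the full function space between finite sets, which is finite up to extensional
-- equality. Finally, for W → ν of order n the elements are the top element, unique up to
-- equality, and the instances X s̄ of the finitely many symbols; each instance is determined
-- by its argument tuple s̄, whose entries have order < n. Choosing representatives of the
-- finitely many classes uses excluded middle.
module Submission where

open import Defs
open import Level using (0ℓ)
open import Axiom.ExcludedMiddle using (ExcludedMiddle)
open import Axiom.UniquenessOfIdentityProofs.WithK using (uip)
open import Data.Bool using (Bool; true; false; _∧_; _∨_; not; T; if_then_else_)
open import Data.Bool.Properties using (T-∧; T-≡; T-not-≡; ∨-zeroʳ)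
open import Data.Empty using (⊥-elim)
open import Data.Fin using (Fin; zero; suc; splitAt; _↑ˡ_; _↑ʳ_)
open import Data.Fin.Properties using (splitAt-↑ˡ; splitAt-↑ʳ)
open import Data.List using (List; []; _∷_; foldr; length)
open import Data.List.Relation.Unary.All as All using (All; []; _∷_)
open import Data.Nat using (ℕ; zero; suc; _+_; _≤_; _<_; _⊔_; _≤ᵇ_; _≡ᵇ_; s≤s; z≤n)
open import Data.Nat.Properties
  using ( ≤ᵇ⇒≤; ≤⇒≤ᵇ; ≡ᵇ⇒≡; ≡⇒≡ᵇ; m≤n⇒m⊔n≡n; m≤m⊔n; m≤n⊔m; m≢1+n+m; ≤-trans; <-≤-trans
        ; ≤-refl; ≤-reflexive; ≤-antisym; ≰⇒>; _≤?_; ≤-irrelevant; <⇒≤; n≮n; n<1+n; n≤1+n; <⇒≢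
        ; m≤n⇒m<n∨m≡n)
open import Data.Product using (Σ; _×_; _,_; proj₁; proj₂; Σ-syntax; ∃-syntax)
open import Data.Sum using (_⊎_; inj₁; inj₂; [_,_])
open import Data.Unit using (⊤; tt)
open import Data.Vec.Functional using () renaming (_∷_ to _∷ᵛ_)
open import Function using (_∘_)
open import Function.Bundles using (Equivalence)
open import Relation.Binary.PropositionalEquality
  using (_≡_; refl; sym; trans; cong; cong₂; subst; module ≡-Reasoning)
open import Relation.Binary.Structures using (IsPartialEquivalence)
open import Relation.Nullary using (¬_; Dec; yes; no; contradiction)
open import Relation.Unary using (Pred; ∅; _∪_; ⋃; _⊆_)

record Lawful {A : Set} (P : PER A) : Set where
  field
    El-refl              : ∀ {x} → El P x → Eq P x x
    isPartialEquivalence : IsPartialEquivalence (Eq P)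
  open IsPartialEquivalence isPartialEquivalence public

El-cast : ∀ {A} {P Q : PER A} {x} → P ≡ Q → El P x → El Q x
El-cast refl x∈P = x∈P

Eq-cast : ∀ {A} {P Q : PER A} {x y} → P ≡ Q → Eq P x y → Eq Q x y
Eq-cast refl x≈y = x≈y

lawful-Disc : ∀ {A} → Lawful (Disc A)
lawful-Disc = record
  { El-refl = λ _ → refl ; isPartialEquivalence = record { sym = sym ; trans = trans } }

lawful-Fun : ∀ {A B} {P : PER A} {Q : PER B} → Lawful Q → Lawful (Fun P Q)
lawful-Fun Q-lawful = record
  { El-refl = λ f∈ x x∈ → Q.El-refl (proj₁ f∈ x x∈)
  ; isPartialEquivalence = record
    { sym = λ f≈g x x∈ → Q.sym (f≈g x x∈)
    ; trans = λ f≈g g≈h x x∈ → Q.trans (f≈g x x∈) (g≈h x x∈)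
    }
  }
  where module Q = Lawful Q-lawful

lawful-pointwise : ∀ {A B} {Q : PER B} (E : (A → B) → Set) → (∀ {f} → E f → ∀ w → El Q (f w)) →
  Lawful Q → Lawful (record { El = E ; Eq = λ f g → ∀ w → Eq Q (f w) (g w) })
lawful-pointwise E E⇒El Q-lawful = record
  { El-refl = λ f∈ w → Q.El-refl (E⇒El f∈ w)
  ; isPartialEquivalence = record
    { sym = λ f≈g w → Q.sym (f≈g w) ; trans = λ f≈g g≈h w → Q.trans (f≈g w) (g≈h w) }
  }
  where module Q = Lawful Q-lawful

⊤ᴾ : PER ⊤
El ⊤ᴾ _ = ⊤
Eq ⊤ᴾ _ _ = ⊤

lawful-⊤ : Lawful ⊤ᴾ
lawful-⊤ = record
  { El-refl = λ _ → tt ; isPartialEquivalence = record { sym = λ _ → tt ; trans = λ _ _ → tt } }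

infixr 2 _×ᴾ_
_×ᴾ_ : ∀ {A B} → PER A → PER B → PER (A × B)
El (P ×ᴾ Q) (x , y) = El P x × El Q y
Eq (P ×ᴾ Q) (x , y) (x′ , y′) = Eq P x x′ × Eq Q y y′

lawful-× : ∀ {A B} {P : PER A} {Q : PER B} → Lawful P → Lawful Q → Lawful (P ×ᴾ Q)
lawful-× P-lawful Q-lawful = record
  { El-refl = λ (x∈ , y∈) → P.El-refl x∈ , Q.El-refl y∈
  ; isPartialEquivalence = record
    { sym = λ (x≈ , y≈) → P.sym x≈ , Q.sym y≈
    ; trans = λ (x≈ , y≈) (x≈′ , y≈′) → P.trans x≈ x≈′ , Q.trans y≈ y≈′
    }
  }
  where
  module P = Lawful P-lawful
  module Q = Lawful Q-lawful

-- `FinitePER P` is `Cover P (El P)`.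
Cover : {A : Set} → PER A → Pred A 0ℓ → Set
Cover {A} P Q =
  ∃[ k ] Σ[ e ∈ (Fin k → A) ] ((∀ i → El P (e i)) × (∀ x → Q x → ∃[ i ] Eq P x (e i)))

module _ {A : Set} (P : PER A) where

  cover-∅ : Cover P ∅
  cover-∅ = 0 , (λ ()) , (λ ()) , λ _ ()

  cover-⊆ : ∀ {Q Q′ : Pred A 0ℓ} → Q ⊆ Q′ → Cover P Q′ → Cover P Q
  cover-⊆ Q⊆Q′ (k , e , e∈P , covers) = k , e , e∈P , λ x x∈Q → covers x (Q⊆Q′ x∈Q)

  cover-singleton : ∀ {c} → El P c → Cover P (λ x → Eq P x c)
  cover-singleton {c} c∈P = 1 , (λ _ → c) , (λ _ → c∈P) , λ _ x≈c → zero , x≈c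

  cover-∪ : ∀ {Q₁ Q₂ : Pred A 0ℓ} → Cover P Q₁ → Cover P Q₂ → Cover P (Q₁ ∪ Q₂)
  cover-∪ {Q₁} {Q₂} (k₁ , e₁ , e₁∈P , covers₁) (k₂ , e₂ , e₂∈P , covers₂) =
    k₁ + k₂ , e∘split , (λ i → [_,_] {C = λ s → El P (e s)} e₁∈P e₂∈P (splitAt k₁ i)) , covers
    where
    e : Fin k₁ ⊎ Fin k₂ → A
    e = [ e₁ , e₂ ]
    e∘split : Fin (k₁ + k₂) → A
    e∘split i = e (splitAt k₁ i)
    covers : ∀ x → (Q₁ ∪ Q₂) x → ∃[ i ] Eq P x (e∘split i)
    covers x (inj₁ x∈Q₁) with covers₁ x x∈Q₁
    ... | i , x≈ = i ↑ˡ k₂ , subst (λ s → Eq P x (e s)) (sym (splitAt-↑ˡ k₁ i k₂)) x≈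
    covers x (inj₂ x∈Q₂) with covers₂ x x∈Q₂
    ... | i , x≈ = k₁ ↑ʳ i , subst (λ s → Eq P x (e s)) (sym (splitAt-↑ʳ k₁ k₂ i)) x≈

  cover-⋃ : ∀ n (Q : Fin n → Pred A 0ℓ) → (∀ i → Cover P (Q i)) → Cover P (⋃ (Fin n) Q)
  cover-⋃ zero Q _ = cover-⊆ (λ { (() , _) }) cover-∅
  cover-⋃ (suc n) Q covers = cover-⊆ split (cover-∪ (covers zero) (cover-⋃ n Q∘suc (λ i → covers (suc i))))
    where
    Q∘suc : Fin n → Pred A 0ℓ
    Q∘suc i = Q (suc i)
    split : ⋃ (Fin (suc n)) Q ⊆ (Q zero ∪ ⋃ (Fin n) Q∘suc)
    split (zero , x∈Q) = inj₁ x∈Q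
    split (suc i , x∈Q) = inj₂ (i , x∈Q)

finite-× : ∀ {A B} {P : PER A} {Q : PER B} → FinitePER P → FinitePER Q → FinitePER (P ×ᴾ Q)
finite-× {A} {B} {P} {Q} (k₁ , e₁ , e₁∈P , covers₁) (k₂ , e₂ , e₂∈Q , covers₂) =
  cover-⊆ P×Q pair-index
    (cover-⋃ P×Q k₁ _ λ i → cover-⋃ P×Q k₂ _ λ j → cover-singleton P×Q (e₁∈P i , e₂∈Q j))
  where
  P×Q : PER (A × B)
  P×Q = P ×ᴾ Q
  pair-index : El P×Q ⊆ (λ z → Σ[ i ∈ Fin k₁ ] Σ[ j ∈ Fin k₂ ] Eq P×Q z (e₁ i , e₂ j))
  pair-index {x , y} (x∈ , y∈) with covers₁ x x∈ | covers₂ y y∈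
  ... | i , x≈ | j , y≈ = i , j , x≈ , y≈

finite-⊤ : FinitePER ⊤ᴾ
finite-⊤ = cover-⊆ ⊤ᴾ (λ _ → tt) (cover-singleton ⊤ᴾ tt)

module _ {B : Set} {Q : PER B} (Q-lawful : Lawful Q) where
  open Lawful Q-lawful using (El-refl)

  Fun-Disc-El : ∀ {A} {f : A → B} → (∀ x → El Q (f x)) → El (Fun (Disc A) Q) f
  Fun-Disc-El f∈ = (λ x _ → f∈ x) , λ { x .x _ _ refl → El-refl (f∈ x) }

  finite-Fun-Fin : ∀ k → FinitePER Q → FinitePER (Fun (Disc (Fin k)) Q)
  finite-Fun-Fin zero _ =
    cover-⊆ Q⁰ (λ _ ()) (cover-singleton Q⁰ (Fun-Disc-El {f = λ ()} λ ()))
    where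
    Q⁰ : PER (Fin 0 → B)
    Q⁰ = Fun (Disc (Fin 0)) Q
  finite-Fun-Fin (suc k) Q-finite@(l , eQ , eQ∈Q , coversQ) with finite-Fun-Fin k Q-finite
  ... | N , eF , eF∈F , coversF =
    cover-⊆ Qᵏ⁺¹ head-tail-index
      (cover-⋃ Qᵏ⁺¹ l _ λ j → cover-⋃ Qᵏ⁺¹ N _ λ i →
         cover-singleton Qᵏ⁺¹ (Fun-Disc-El (cons∈ j i)))
    where
    Qᵏ⁺¹ : PER (Fin (suc k) → B)
    Qᵏ⁺¹ = Fun (Disc (Fin (suc k))) Q
    cons∈ : ∀ j i x → El Q ((eQ j ∷ᵛ eF i) x)
    cons∈ j i zero = eQ∈Q j
    cons∈ j i (suc x) = proj₁ (eF∈F i) x tt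
    head-tail-index : El Qᵏ⁺¹ ⊆ (λ t → Σ[ j ∈ Fin l ] Σ[ i ∈ Fin N ] Eq Qᵏ⁺¹ t (eQ j ∷ᵛ eF i))
    head-tail-index {t} t∈ with coversQ (t zero) (proj₁ t∈ zero tt)
                             | coversF (λ x → t (suc x)) (Fun-Disc-El (λ x → proj₁ t∈ (suc x) tt))
    ... | j , head≈ | i , tail≈ = j , i , λ { zero _ → head≈ ; (suc x) _ → tail≈ x tt }

module _ (em : ExcludedMiddle 0ℓ) where

  -- One member of Q is chosen, by excluded middle, for each index of R.
  cover-classified : ∀ {A I : Set} {P : PER A} {R : PER I} {Q : Pred A 0ℓ} →
    FinitePER R → Lawful R → (C : A → I → Set) →
    (∀ {x} → Q x → El P x × Σ[ i ∈ I ] (El R i × C x i)) →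
    (∀ {x y i j} → C x i → C y j → Eq R i j → Eq P x y) →
    Cover P Q
  cover-classified {A} {I} {P} {R} {Q} (k , eR , eR∈R , coversR) R-lawful C classify respects
    with em {Σ A Q}
  ... | no Q-empty = cover-⊆ P (λ {x} x∈Q → Q-empty (x , x∈Q)) (cover-∅ P)
  ... | yes (x₀ , x₀∈Q) = k , e , e∈P , covers
    where
    module R′ = Lawful R-lawful
    Classified : Fin k → Pred A 0ℓ
    Classified j x = Q x × Σ[ i ∈ I ] (El R i × C x i × Eq R i (eR j))
    choose : ∀ j → Dec (Σ A (Classified j)) → A
    choose j (yes (x , _)) = x
    choose j (no _) = x₀
    e : Fin k → A
    e j = choose j em
    choose∈P : ∀ j d → El P (choose j d)
    choose∈P j (yes (x , x∈Q , _)) = proj₁ (classify x∈Q)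
    choose∈P j (no _) = proj₁ (classify x₀∈Q)
    e∈P : ∀ j → El P (e j)
    e∈P j = choose∈P j em
    choose≈ : ∀ j d {x} → Classified j x → Eq P x (choose j d)
    choose≈ j (yes (_ , _ , i′ , _ , Cyi′ , i′≈)) (_ , i , _ , Cxi , i≈) =
      respects Cxi Cyi′ (R′.trans i≈ (R′.sym i′≈))
    choose≈ j (no none) {x} x∈ = ⊥-elim (none (x , x∈))
    covers : ∀ x → Q x → ∃[ j ] Eq P x (e j)
    covers x x∈Q with classify x∈Q
    ... | _ , i , i∈R , Cxi with coversR i i∈R
    ... | j , i≈ = j , choose≈ j em (x∈Q , i , i∈R , Cxi , i≈)

  cover-subsingleton : ∀ {A} {P : PER A} {Q : Pred A 0ℓ} →
    Q ⊆ El P → (∀ {x y} → Q x → Q y → Eq P x y) → Cover P Q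
  cover-subsingleton {Q = Q} Q⊆P unique =
    cover-classified finite-⊤ lawful-⊤ (λ x _ → Q x) (λ x∈Q → Q⊆P x∈Q , tt , tt , x∈Q)
      (λ x∈Q y∈Q _ → unique x∈Q y∈Q)

  -- A function on a finite set is determined, up to equality, by its table of values.
  finite-Fun : ∀ {A B} {P : PER A} {Q : PER B} →
    FinitePER P → FinitePER Q → Lawful Q → FinitePER (Fun P Q)
  finite-Fun {A} {B} {P} {Q} (k , eP , eP∈P , coversP) Q-finite Q-lawful =
    cover-classified (finite-Fun-Fin Q-lawful k Q-finite) (lawful-Fun Q-lawful) Table
      (λ f∈ → f∈ , _ , Fun-Disc-El Q-lawful (λ i → proj₁ f∈ (eP i) (eP∈P i)) , f∈ ,
              λ i _ → Q′.El-refl (proj₁ f∈ (eP i) (eP∈P i)))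
      agree
    where
    module Q′ = Lawful Q-lawful
    Table : (A → B) → (Fin k → B) → Set
    Table f t = El (Fun P Q) f × (∀ i → ⊤ → Eq Q (f (eP i)) (t i))
    agree : ∀ {f g t u} → Table f t → Table g u → Eq (Fun (Disc (Fin k)) Q) t u → Eq (Fun P Q) f g
    agree (f∈ , f≈t) (g∈ , g≈u) t≈u x x∈ with coversP x x∈
    ... | i , x≈ =
      Q′.trans (proj₂ f∈ x (eP i) x∈ (eP∈P i) x≈)
        (Q′.trans (f≈t i tt)
          (Q′.trans (t≈u i tt)
            (Q′.trans (Q′.sym (g≈u i tt)) (Q′.sym (proj₂ g∈ x (eP i) x∈ (eP∈P i) x≈)))))

∧-elim : ∀ {x y} → T (x ∧ y) → T x × T y
∧-elim = Equivalence.to T-∧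

∧-intro : ∀ {x y} → T x → T y → T (x ∧ y)
∧-intro x y = Equivalence.from T-∧ (x , y)

∨-monoˡ : ∀ {x x′} y → (T x′ → T x) → T (x′ ∨ y) → T (x ∨ y)
∨-monoˡ {true} y _ _ = _
∨-monoˡ {false} {true} y x′⇒x _ = ⊥-elim (x′⇒x _)
∨-monoˡ {false} {false} y _ h = h

allB-∷-mono : ∀ {ps qs} k → (∀ p → T (allB ps p) → T (allB qs p)) →
              ∀ p → T (allB (k ∷ ps) p) → T (allB (k ∷ qs) p)
allB-∷-mono k ps⇒qs p h = ∧-intro (proj₁ (∧-elim {p k} h)) (ps⇒qs p (proj₂ (∧-elim {p k} h)))

not-mono : ∀ {x x′} → (T x′ → T x) → T (not x) → T (not x′)
not-mono {false} {false} _ _ = _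
not-mono {false} {true} x′⇒x _ = x′⇒x _

ini-weaken : ∀ ρ {ps qs w w′} → (∀ p → T (allB ps p) → T (allB qs p)) → (T w′ → T w) →
             T (ini ps w ρ) → T (ini qs w′ ρ)
ini-weaken o _ _ _ = _
ini-weaken (a ⇒ r) {ps} {qs} {w} {w′} ps⇒qs w′⇒w h with isW a | ∧-elim {argOK a} h
... | false | a-ok , r-ok =
  ∧-intro a-ok (ini-weaken r (allB-∷-mono {ps} {qs} (order a) ps⇒qs) (∨-monoˡ false w′⇒w) r-ok)
... | true | a-ok , W-ok∧r-ok with ∧-elim {not w ∧ _} W-ok∧r-ok
...   | W-ok , r-ok with ∧-elim {not w} W-ok
...     | ¬w , ps-ok =
  ∧-intro a-ok (∧-intro (∧-intro (not-mono w′⇒w ¬w) (ps⇒qs _ ps-ok))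
                        (ini-weaken r (allB-∷-mono {ps} {qs} (order a) ps⇒qs) (∨-monoˡ true w′⇒w) r-ok))

initial-⇒ : ∀ a r → Initial (a ⇒ r) → T (argOK a) × Initial r
initial-⇒ a r h with ∧-elim {argOK a} h
... | a-ok , W-ok∧r-ok =
  a-ok , ini-weaken r (λ _ _ → _) (λ ()) (proj₂ (∧-elim {if isW a then true else true} W-ok∧r-ok))

ini-after-W⇒inactive : ∀ ρ {ps} → T (ini ps true ρ) → Inactive ρ
ini-after-W⇒inactive o _ = _
ini-after-W⇒inactive (a ⇒ r) h with isW a | ∧-elim {argOK a} h
... | false | _ , r-ok = ini-after-W⇒inactive r r-ok
... | true | _ , ()

inactive-⇒ : ∀ a r → Inactive (a ⇒ r) → isW a ≡ false × Inactive r
inactive-⇒ a r h with isW a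
... | false = refl , h

infixr 5 _⇒*_
_⇒*_ : List Ty → Ty → Ty
τs ⇒* U = foldr _⇒_ U τs

SpineArg : Ty → Ty → Set
SpineArg r τ = isW τ ≡ false × T (argOK τ) × order τ < order (W ⇒ r)

not-∨ : ∀ {x y} → T (not (x ∨ y)) → T (not x) × T (not y)
not-∨ {false} h = _ , h

spine-args′ : ∀ r τs {ps w} → T (ini ps w (τs ⇒* (W ⇒ r))) →
  All (SpineArg r) τs × T (not w) × T (allB ps (λ p → suc p ≤ᵇ order (W ⇒ r)))
spine-args′ r [] {w = w} h = [] , ∧-elim {not w} (proj₁ (∧-elim {not w ∧ _} h))
spine-args′ r (τ ∷ τs) {w = w} h with ∧-elim {argOK τ} h
... | τ-ok , cond∧rest with spine-args′ r τs (proj₂ (∧-elim {if isW τ then _ else true} cond∧rest))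
... | args , ¬w∨W , τ∷ps-ok with not-∨ {w} ¬w∨W | ∧-elim {suc (order τ) ≤ᵇ order (W ⇒ r)} τ∷ps-ok
... | ¬w , τ≢W | τ< , ps-ok = (Equivalence.to T-not-≡ τ≢W , τ-ok , ≤ᵇ⇒≤ _ _ τ<) ∷ args , ¬w , ps-ok

spine-args : ∀ r τs → Initial (τs ⇒* (W ⇒ r)) → All (SpineArg r) τs
spine-args r τs h = proj₁ (spine-args′ r τs h)

spine-order : ∀ r {τs} → All (SpineArg r) τs → order (τs ⇒* (W ⇒ r)) ≡ order (W ⇒ r)
spine-order r [] = refl
spine-order r {τ ∷ τs} ((_ , _ , τ<) ∷ args) =
  trans (cong (suc (order τ) ⊔_) (spine-order r args)) (m≤n⇒m⊔n≡n τ<)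

arity : Ty → ℕ
arity (_ ⇒ r) = suc (arity r)
arity _ = 0

arity-⇒* : ∀ U τs → arity (τs ⇒* U) ≡ length τs + arity U
arity-⇒* U [] = refl
arity-⇒* U (_ ∷ τs) = cong suc (arity-⇒* U τs)

⇒*-injectiveˡ : ∀ U τs τs′ → τs ⇒* U ≡ τs′ ⇒* U → τs ≡ τs′
⇒*-injectiveˡ U [] [] _ = refl
⇒*-injectiveˡ U [] τs′@(_ ∷ _) eq =
  contradiction (trans (cong arity eq) (arity-⇒* U τs′)) (m≢1+n+m (arity U))
⇒*-injectiveˡ U τs@(_ ∷ _) [] eq =
  contradiction (trans (cong arity (sym eq)) (arity-⇒* U τs)) (m≢1+n+m (arity U))
⇒*-injectiveˡ U (τ ∷ τs) (τ′ ∷ τs′) eq =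
  cong₂ _∷_ (cong domain eq) (⇒*-injectiveˡ U τs τs′ (cong codomain eq))
  where
  domain codomain : Ty → Ty
  domain (a ⇒ _) = a
  domain a = a
  codomain (_ ⇒ r) = r
  codomain r = r

WithinOrder : ℕ → Ty → Set
WithinOrder n σ = order σ < n ⊎ (order σ ≡ n × Inactive σ)

¬T⇒≡false : ∀ {b} → ¬ T b → b ≡ false
¬T⇒≡false {false} _ = refl
¬T⇒≡false {true} ¬T = contradiction _ ¬T

1+n≰ᵇn : ∀ n → (suc n ≤ᵇ n) ≡ false
1+n≰ᵇn n = ¬T⇒≡false (n≮n n ∘ ≤ᵇ⇒≤ _ _)

2+n≰ᵇn : ∀ n → (suc (suc n) ≤ᵇ n) ≡ false
2+n≰ᵇn n = ¬T⇒≡false (λ h → n≮n n (≤-trans (n≤1+n (suc n)) (≤ᵇ⇒≤ _ _ h)))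

≡ᵇ-refl : ∀ n → (n ≡ᵇ n) ≡ true
≡ᵇ-refl n = Equivalence.to T-≡ (≡⇒≡ᵇ n n refl)

1+n≢ᵇn : ∀ n → (suc n ≡ᵇ n) ≡ false
1+n≢ᵇn n = ¬T⇒≡false (λ h → <⇒≢ (n<1+n n) (sym (≡ᵇ⇒≡ _ _ h)))

-- `classify m (a ⇒ r)` with `initial`, `active` and `order` of `a ⇒ r` abstracted.
classify⇒ : Bool → Bool → ℕ → ℕ → Case
classify⇒ ini act k m =
  if (ini ∧ (suc k ≤ᵇ m)) ∨ (((false ∨ (ini ∧ not act)) ∧ (k ≤ᵇ m)) ∨ false)
  then case-i
  else if ini ∧ act ∧ (k ≡ᵇ m)
  then case-ii
  else if ini ∧ (k ≡ᵇ suc m)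
  then case-iii
  else case-iv

classify⇒-i : ∀ {ini act k m} → T ini → k < m ⊎ (k ≡ m × T (not act)) → classify⇒ ini act k m ≡ case-i
classify⇒-i {true} _ (inj₁ k<m) rewrite Equivalence.to T-≡ (≤⇒≤ᵇ k<m) = refl
classify⇒-i {true} {false} {k} _ (inj₂ (refl , _))
  rewrite Equivalence.to T-≡ (≤⇒≤ᵇ (≤-refl {k})) | ∨-zeroʳ (suc k ≤ᵇ k) = refl

classify⇒-ii : ∀ {ini act k m} → T ini → act ≡ true → k ≡ m → classify⇒ ini act k m ≡ case-ii
classify⇒-ii {true} {m = m} _ refl refl rewrite 1+n≰ᵇn m | ≡ᵇ-refl m = refl

classify⇒-iii : ∀ {ini act k m} → T ini → k ≡ suc m → classify⇒ ini act k m ≡ case-iii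
classify⇒-iii {true} {act} {m = m} _ refl rewrite 2+n≰ᵇn m | 1+n≰ᵇn m | 1+n≢ᵇn m | ≡ᵇ-refl m with act
... | true = refl
... | false = refl

order-dom< : ∀ a r → order a < order (a ⇒ r)
order-dom< a r = m≤m⊔n (suc (order a)) (order r)

order-cod≤ : ∀ a r → order r ≤ order (a ⇒ r)
order-cod≤ a r = m≤n⊔m (suc (order a)) (order r)

order-⇒-pos : ∀ a r → 0 < order (a ⇒ r)
order-⇒-pos a r = ≤-trans (s≤s z≤n) (order-dom< a r)

initial⇒argOK : ∀ σ → Initial σ → T (argOK σ)
initial⇒argOK o h = h
initial⇒argOK (_ ⇒ _) h = h

within-inactive : ∀ {n} σ → order σ ≤ n → Inactive σ → WithinOrder n σ
within-inactive _ σ≤n inactive with m≤n⇒m<n∨m≡n σ≤n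
... | inj₁ σ<n = inj₁ σ<n
... | inj₂ σ≡n = inj₂ (σ≡n , inactive)

within⇒≤ : ∀ {n} σ → WithinOrder n σ → order σ ≤ n
within⇒≤ _ (inj₁ σ<n) = <⇒≤ σ<n
within⇒≤ _ (inj₂ (σ≡n , _)) = ≤-reflexive σ≡n

W-or-not : ∀ a → a ≡ W ⊎ isW a ≡ false
W-or-not S = inj₂ refl
W-or-not W = inj₁ refl
W-or-not o = inj₂ refl
W-or-not (_ ⇒ _) = inj₂ refl

data Regime (m : ℕ) (σ : Ty) : Set where
  clause-i   : WithinOrder m σ → Regime m σ
  clause-ii  : order σ ≡ m → active σ ≡ true → Regime m σ
  clause-iii : order σ ≡ suc m → Inactive σ → Regime m σ

regime : ∀ m σ → WithinOrder (suc m) σ → Regime m σ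
regime m σ (inj₂ (ord , inactive)) = clause-iii ord inactive
regime m σ (inj₁ (s≤s ord≤m)) with m≤n⇒m<n∨m≡n ord≤m
... | inj₁ ord<m = clause-i (inj₁ ord<m)
... | inj₂ ord≡m with active σ in act
...   | true = clause-ii ord≡m act
...   | false = clause-i (inj₂ (ord≡m , Equivalence.from T-not-≡ act))

module _ (𝒜 : Setting) where
  open Setting 𝒜
  open Construction 𝒜

  lawful-Std : ∀ σ → Lawful (Std σ)
  lawful-Std S = lawful-Disc
  lawful-Std W = lawful-Disc
  lawful-Std o = lawful-Disc
  lawful-Std (a ⇒ r) = lawful-Fun (lawful-Std r)

  mutual
    lawful-F : ∀ m b σ → Lawful (F m b σ)
    lawful-F m b S = lawful-Disc
    lawful-F m b W = lawful-Disc
    lawful-F m b o = lawful-Disc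
    lawful-F m b (W ⇒ r) = lawful-FW m b r (classify m (W ⇒ r))
    lawful-F m b (S ⇒ r) = lawful-FArr m b S r (classify m (S ⇒ r))
    lawful-F m b (o ⇒ r) = lawful-FArr m b o r (classify m (o ⇒ r))
    lawful-F m b ((a₁ ⇒ a₂) ⇒ r) = lawful-FArr m b (a₁ ⇒ a₂) r (classify m ((a₁ ⇒ a₂) ⇒ r))

    lawful-FArr : ∀ m b a r c → Lawful (FArr m b a r c)
    lawful-FArr m b a r case-i = lawful-prev m b (a ⇒ r)
    lawful-FArr m b a r case-ii = lawful-Fun (lawful-F m b r)
    lawful-FArr m b a r case-iii = lawful-Fun (lawful-F m b r)
    lawful-FArr m b a r case-iv = lawful-Fun (lawful-F m b r)

    lawful-FW : ∀ m b r c → Lawful (FW m b r c)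
    lawful-FW m b r case-i = lawful-prev m b (W ⇒ r)
    lawful-FW m b r case-ii = lawful-pointwise _ proj₁ (lawful-prev m b r)
    lawful-FW m b r case-iii = lawful-pointwise _ proj₁ (lawful-F m b r)
    lawful-FW m b r case-iv = lawful-Fun (lawful-F m b r)

    lawful-prev : ∀ m b σ → Lawful (prev m b σ)
    lawful-prev zero _ σ = lawful-Std σ
    lawful-prev (suc k) (b , _) σ = lawful-F k b σ

  F-non-W⇒ : ∀ m b a r → isW a ≡ false → F m b (a ⇒ r) ≡ FArr m b a r (classify m (a ⇒ r))
  F-non-W⇒ m b S r _ = refl
  F-non-W⇒ m b o r _ = refl
  F-non-W⇒ m b (_ ⇒ _) r _ = refl

  F-≡-prev : ∀ m b a r → classify m (a ⇒ r) ≡ case-i → F m b (a ⇒ r) ≡ prev m b (a ⇒ r)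
  F-≡-prev m b W r eq = cong (FW m b r) eq
  F-≡-prev m b S r eq = cong (FArr m b S r) eq
  F-≡-prev m b o r eq = cong (FArr m b o r) eq
  F-≡-prev m b (a₁ ⇒ a₂) r eq = cong (FArr m b (a₁ ⇒ a₂) r) eq

  F-clause-i : ∀ m b a r → Initial (a ⇒ r) → WithinOrder m (a ⇒ r) → F m b (a ⇒ r) ≡ prev m b (a ⇒ r)
  F-clause-i m b a r ini within = F-≡-prev m b a r (classify⇒-i {initial (a ⇒ r)} {active (a ⇒ r)} ini within)

  F-clause-ii : ∀ m b a r → isW a ≡ false → Initial (a ⇒ r) → active (a ⇒ r) ≡ true → order (a ⇒ r) ≡ m →
    F m b (a ⇒ r) ≡ Fun (F m b a) (F m b r)
  F-clause-ii m b a r a≢W ini act ord =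
    trans (F-non-W⇒ m b a r a≢W) (cong (FArr m b a r) (classify⇒-ii {initial (a ⇒ r)} ini act ord))

  F-clause-iii : ∀ m b a r → isW a ≡ false → Initial (a ⇒ r) → order (a ⇒ r) ≡ suc m →
    F m b (a ⇒ r) ≡ Fun (F m b a) (F m b r)
  F-clause-iii m b a r a≢W ini ord =
    trans (F-non-W⇒ m b a r a≢W) (cong (FArr m b a r) (classify⇒-iii {initial (a ⇒ r)} {active (a ⇒ r)} ini ord))

  F-W⇒-clause-ii : ∀ m b r → Initial (W ⇒ r) → order (W ⇒ r) ≡ m → F m b (W ⇒ r) ≡ FW m b r case-ii
  F-W⇒-clause-ii m b r ini ord = cong (FW m b r) (classify⇒-ii {initial (W ⇒ r)} ini refl ord)

  F-W⇒-clause-iii : ∀ m b r → Initial (W ⇒ r) → order (W ⇒ r) ≡ suc m → F m b (W ⇒ r) ≡ FW m b r case-iii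
  F-W⇒-clause-iii m b r ini ord = cong (FW m b r) (classify⇒-iii {initial (W ⇒ r)} {true} ini ord)

  F-step : ∀ k b new σ → T (argOK σ) → WithinOrder (suc k) σ → F (suc k) (b , new) σ ≡ F k b σ
  F-step k b new S _ _ = refl
  F-step k b new W _ _ = refl
  F-step k b new o _ _ = refl
  F-step k b new (a ⇒ r) ini within = F-clause-i (suc k) (b , new) a r ini within

  -- Clause (i) keeps inactive types of order ≤ j + 1 at the frame where clause (iii) made them
  -- full function spaces.
  F-inactive : ∀ j b a r → Initial (a ⇒ r) → Inactive (a ⇒ r) → order (a ⇒ r) ≤ suc j →
    F j b (a ⇒ r) ≡ Fun (F j b a) (F j b r)
  F-inactive j b a r ini inactive ord≤ with m≤n⇒m<n∨m≡n ord≤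
  ... | inj₂ ord≡ = F-clause-iii j b a r (proj₁ (inactive-⇒ a r inactive)) ini ord≡
  F-inactive zero b a r ini inactive ord≤ | inj₁ (s≤s ord≤0) =
    contradiction (≤-trans (order-⇒-pos a r) ord≤0) λ ()
  F-inactive (suc k) (b , new) a r ini inactive ord≤ | inj₁ (s≤s ord≤k+1) = begin
    F (suc k) (b , new) (a ⇒ r)
      ≡⟨ F-clause-i (suc k) (b , new) a r ini (within-inactive (a ⇒ r) ord≤k+1 inactive) ⟩
    F k b (a ⇒ r)
      ≡⟨ F-inactive k b a r ini inactive ord≤k+1 ⟩
    Fun (F k b a) (F k b r)
      ≡⟨ sym (cong₂ Fun (F-step k b new a a-ok (inj₁ a<)) (F-step k b new r r-ok r-within)) ⟩
    Fun (F (suc k) (b , new) a) (F (suc k) (b , new) r) ∎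
    where
    open ≡-Reasoning
    a-ok : T (argOK a)
    a-ok = proj₁ (initial-⇒ a r ini)
    r-ok : T (argOK r)
    r-ok = initial⇒argOK r (proj₂ (initial-⇒ a r ini))
    a< : order a < suc k
    a< = <-≤-trans (order-dom< a r) ord≤k+1
    r-within : WithinOrder (suc k) r
    r-within = within-inactive r (≤-trans (order-cod≤ a r) ord≤k+1) (proj₂ (inactive-⇒ a r inactive))

  top-unique : ∀ j b ρ → Initial ρ → Inactive ρ → order ρ ≤ suc j →
    ∀ {x y} → IsTop (F j b) ρ x → IsTop (F j b) ρ y → Eq (F j b ρ) x y
  top-unique j b o _ _ _ x-top y-top = trans x-top (sym y-top)
  top-unique j b (a ⇒ r) ini inactive ord≤ x-top y-top =
    Eq-cast (sym (F-inactive j b a r ini inactive ord≤))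
      λ z z∈ → top-unique j b r (proj₂ (initial-⇒ a r ini)) (proj₂ (inactive-⇒ a r inactive))
                 (≤-trans (order-cod≤ a r) ord≤) (x-top z z∈) (y-top z z∈)

  val-El : ∀ j b new X p → order (ty X) ≡ suc j → El (F j b (ty X)) (val (suc j) (b , new) X p)
  val-El zero b new X p _ = proj₂ (new X p)
  val-El (suc k) b new X p ord with order (ty X) ≤? suc k
  ... | yes ord≤k+1 = contradiction (subst (_≤ suc k) ord ord≤k+1) (n≮n (suc k))
  ... | no ord≰k+1 = proj₂ (new X (≤-antisym p (≰⇒> ord≰k+1)))

  Tuple : ((σ : Ty) → PER (D σ)) → (τs : List Ty) → PER (ArgVals τs)
  El (Tuple G τs) = AllEl G τs
  Eq (Tuple G []) _ _ = ⊤
  Eq (Tuple G (τ ∷ τs)) (x , xs) (y , ys) = Eq (G τ) x y × Eq (Tuple G τs) xs ys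

  lawful-Tuple : ∀ {G} → (∀ σ → Lawful (G σ)) → ∀ τs → Lawful (Tuple G τs)
  lawful-Tuple G-lawful [] = lawful-⊤
  lawful-Tuple {G} G-lawful (τ ∷ τs) =
    lawful-× {P = G τ} {Q = Tuple G τs} (G-lawful τ) (lawful-Tuple G-lawful τs)

  finite-Tuple : ∀ {G} τs → All (λ τ → FinitePER (G τ)) τs → FinitePER (Tuple G τs)
  finite-Tuple [] [] = finite-⊤
  finite-Tuple {G} (τ ∷ τs) (τ-finite ∷ τs-finite) =
    finite-× {P = G τ} {Q = Tuple G τs} τ-finite (finite-Tuple τs τs-finite)

  -- A symbol τs → W → r of order j + 1 lives in full function spaces (clause (iii)) all
  -- along its spine, so applying it respects equality of both function and arguments.
  appSp-cong : ∀ j b r τs → Initial (τs ⇒* (W ⇒ r)) → order (W ⇒ r) ≡ suc j →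
    ∀ {u u′} → El (F j b (τs ⇒* (W ⇒ r))) u → Eq (F j b (τs ⇒* (W ⇒ r))) u u′ →
    ∀ {s s′} → El (Tuple (F j b) τs) s → El (Tuple (F j b) τs) s′ → Eq (Tuple (F j b) τs) s s′ →
    ∀ w → Eq (F j b r) (appSp τs (W ⇒ r) u s w) (appSp τs (W ⇒ r) u′ s′ w)
  appSp-cong j b r [] ini ord _ u≈u′ _ _ _ = Eq-cast (F-W⇒-clause-iii j b r ini ord) u≈u′
  appSp-cong j b r (τ ∷ τs) ini ord {u} {u′} u∈ u≈u′ {x , xs} {x′ , xs′}
             (x∈ , xs∈) (x′∈ , xs′∈) (x≈x′ , xs≈xs′) =
    appSp-cong j b r τs (proj₂ (initial-⇒ τ ρ ini)) ord (proj₁ u∈Fun x x∈)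
      (Lawful.trans (lawful-F j b ρ) (proj₂ u∈Fun x x′ x∈ x′∈ x≈x′) (u≈u′Fun x′ x′∈))
      xs∈ xs′∈ xs≈xs′
    where
    ρ : Ty
    ρ = τs ⇒* (W ⇒ r)
    args : All (SpineArg r) (τ ∷ τs)
    args = spine-args r (τ ∷ τs) ini
    F≡Fun : F j b (τ ⇒ ρ) ≡ Fun (F j b τ) (F j b ρ)
    F≡Fun = F-clause-iii j b τ ρ (proj₁ (All.head args)) ini (trans (spine-order r args) ord)
    u∈Fun : El (Fun (F j b τ) (F j b ρ)) u
    u∈Fun = El-cast F≡Fun u∈
    u≈u′Fun : Eq (Fun (F j b τ) (F j b ρ)) u u′
    u≈u′Fun = Eq-cast F≡Fun u≈u′

  El-subst : ∀ (G : (σ : Ty) → PER (D σ)) {σ τ} (eq : σ ≡ τ) {v} → El (G σ) v → El (G τ) (subst D eq v)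
  El-subst G refl v∈ = v∈

  InstanceOf : ∀ m b r (X : Sym) → D (W ⇒ r) → Set
  InstanceOf m b r X f =
    Σ[ p ∈ InΞ m (order (ty X)) ] Σ[ τs ∈ List Ty ] Σ[ eq ∈ ty X ≡ τs ⇒* (W ⇒ r) ] Σ[ s ∈ ArgVals τs ]
      (AllEl (prev m b) τs s × (∀ w → Eq (prev m b r) (f w) (appSp τs (W ⇒ r) (subst D eq (val m b X p)) s w)))

  -- τs is determined by ty X, and p, eq are proof-irrelevant.
  instance-canonical : ∀ j b r X (p₀ : InΞ (suc j) (order (ty X))) τs₀ (eq₀ : ty X ≡ τs₀ ⇒* (W ⇒ r)) →
    ∀ {f} → InstanceOf (suc j) b r X f →
    Σ[ s ∈ ArgVals τs₀ ] (AllEl (prev (suc j) b) τs₀ s ×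
      (∀ w → Eq (prev (suc j) b r) (f w) (appSp τs₀ (W ⇒ r) (subst D eq₀ (val (suc j) b X p₀)) s w)))
  instance-canonical j b r X p₀ τs₀ eq₀ (p , τs , eq , s , s∈ , f≈)
    with ⇒*-injectiveˡ (W ⇒ r) τs τs₀ (trans (sym eq) eq₀)
  ... | refl with ≤-irrelevant p p₀ | uip eq eq₀
  ... | refl | refl = s , s∈ , f≈

  finite-Bool : FinitePER (Disc Bool)
  finite-Bool = 2 , (λ { zero → true ; (suc _) → false }) , (λ _ → _) ,
    λ { true _ → zero , refl ; false _ → suc zero , refl }

  finite-SCar : FinitePER (Disc SCar)
  finite-SCar with S-finite
  ... | k , e , covers = k , e , (λ _ → _) , λ s _ → proj₁ (covers s) , sym (proj₂ (covers s))

  FiniteUpTo : ℕ → ((σ : Ty) → PER (D σ)) → Set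
  FiniteUpTo n G = ∀ σ → Initial σ → WithinOrder n σ → FinitePER (G σ)

  finite-argument : ∀ m b a → isW a ≡ false → T (argOK a) → order a < suc m →
    (Initial a → WithinOrder (suc m) a → FinitePER (F m b a)) → FinitePER (F m b a)
  finite-argument m b S _ _ _ _ = finite-SCar
  finite-argument m b o _ _ _ _ = finite-Bool
  finite-argument m b (_ ⇒ _) _ ini a< finite-a = finite-a ini (inj₁ a<)

  module _ (em : ExcludedMiddle 0ℓ) where

    module _ (j : ℕ) (b : Ent j)
             (new : (X : Sym) → Fresh (suc j) (order (ty X)) → Σ[ v ∈ D (ty X) ] El (F j b (ty X)) v)
             (r : Ty) (ini : Initial (W ⇒ r)) (ord : order (W ⇒ r) ≡ suc j)
             (IH : FiniteUpTo (suc j) (F j b)) where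

      private
        P : PER (D (W ⇒ r))
        P = FW (suc j) (b , new) r case-ii

      cover-tops : Cover P (λ f → El P f × (∀ w → IsTop (F j b) r (f w)))
      cover-tops = cover-subsingleton em proj₁ λ (_ , f-top) (_ , g-top) w →
        top-unique j b r (proj₂ (initial-⇒ W r ini)) (ini-after-W⇒inactive r ini)
          (≤-trans (order-cod≤ W r) (≤-reflexive ord)) (f-top w) (g-top w)

      -- Instances of X are classified by their (finitely many) argument tuples.
      cover-instances : ∀ X → Cover P (λ f → El P f × InstanceOf (suc j) (b , new) r X f)
      cover-instances X with em {Σ[ p ∈ InΞ (suc j) (order (ty X)) ] Σ[ τs ∈ List Ty ] ty X ≡ τs ⇒* (W ⇒ r)}
      ... | no not-shaped = cover-⊆ P (λ (_ , p , τs , eq , _) → not-shaped (p , τs , eq)) (cover-∅ P)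
      ... | yes (p₀ , τs₀ , eq₀) =
        cover-classified em (finite-Tuple τs₀ (All.map finite-τ args)) (lawful-Tuple (lawful-F j b) τs₀)
          Applied (λ (f∈ , inst) → f∈ , canonical inst) respects
        where
        spine-initial : Initial (τs₀ ⇒* (W ⇒ r))
        spine-initial = subst Initial eq₀ (ty-initial X)
        args : All (SpineArg r) τs₀
        args = spine-args r τs₀ spine-initial
        finite-τ : ∀ {τ} → SpineArg r τ → FinitePER (F j b τ)
        finite-τ {τ} (τ≢W , τ-ok , τ<) = finite-argument j b τ τ≢W τ-ok (subst (order τ <_) ord τ<) (IH τ)
        v₀ : D (τs₀ ⇒* (W ⇒ r))
        v₀ = subst D eq₀ (val (suc j) (b , new) X p₀)
        v₀∈ : El (F j b (τs₀ ⇒* (W ⇒ r))) v₀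
        v₀∈ = El-subst (F j b) eq₀ (val-El j b new X p₀ (trans (cong order eq₀) (trans (spine-order r args) ord)))
        Applied : D (W ⇒ r) → ArgVals τs₀ → Set
        Applied f s = El (Tuple (F j b) τs₀) s × (∀ w → Eq (F j b r) (f w) (appSp τs₀ (W ⇒ r) v₀ s w))
        canonical : ∀ {f} → InstanceOf (suc j) (b , new) r X f →
          Σ[ s ∈ ArgVals τs₀ ] (El (Tuple (F j b) τs₀) s × Applied f s)
        canonical inst with instance-canonical j (b , new) r X p₀ τs₀ eq₀ inst
        ... | s , s∈ , f≈ = s , s∈ , s∈ , f≈
        respects : ∀ {f g s s′} → Applied f s → Applied g s′ → Eq (Tuple (F j b) τs₀) s s′ → Eq P f g
        respects (s∈ , f≈) (s′∈ , g≈) s≈s′ w =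
          R.trans (f≈ w)
            (R.trans (appSp-cong j b r τs₀ spine-initial ord v₀∈ v₀≈v₀ s∈ s′∈ s≈s′ w) (R.sym (g≈ w)))
          where
          module R = Lawful (lawful-F j b r)
          v₀≈v₀ : Eq (F j b (τs₀ ⇒* (W ⇒ r))) v₀ v₀
          v₀≈v₀ = Lawful.El-refl (lawful-F j b (τs₀ ⇒* (W ⇒ r))) v₀∈

      finite-clause-ii : FinitePER P
      finite-clause-ii =
        cover-⊆ P top-or-instance (cover-∪ P cover-tops (cover-⋃ P nSym _ cover-instances))
        where
        top-or-instance : ∀ {f} → El P f → (El P f × (∀ w → IsTop (F j b) r (f w)))
                                         ⊎ (Σ[ X ∈ Sym ] (El P f × InstanceOf (suc j) (b , new) r X f))
        top-or-instance f∈@(_ , inj₁ f-top) = inj₁ (f∈ , f-top)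
        top-or-instance f∈@(_ , inj₂ (X , inst)) = inj₂ (X , f∈ , inst)

    finite-W⇒-clause-ii : ∀ m b r → Initial (W ⇒ r) → order (W ⇒ r) ≡ m →
      FiniteUpTo m (prev m b) → FinitePER (F m b (W ⇒ r))
    finite-W⇒-clause-ii zero b r ini ord IH = contradiction ord (<⇒≢ (order-⇒-pos W r) ∘ sym)
    finite-W⇒-clause-ii (suc j) (b , new) r ini ord IH =
      subst FinitePER (sym (F-W⇒-clause-ii (suc j) (b , new) r ini ord)) (finite-clause-ii j b new r ini ord IH)

    finite-⇒ : ∀ m b a r → isW a ≡ false → Initial (a ⇒ r) → WithinOrder (suc m) (a ⇒ r) →
      F m b (a ⇒ r) ≡ Fun (F m b a) (F m b r) →
      (Initial a → WithinOrder (suc m) a → FinitePER (F m b a)) → FinitePER (F m b r) →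
      FinitePER (F m b (a ⇒ r))
    finite-⇒ m b a r a≢W ini within F≡Fun finite-a r-finite =
      subst FinitePER (sym F≡Fun) (finite-Fun em a-finite r-finite (lawful-F m b r))
      where
      a-finite : FinitePER (F m b a)
      a-finite = finite-argument m b a a≢W (proj₁ (initial-⇒ a r ini))
                   (<-≤-trans (order-dom< a r) (within⇒≤ (a ⇒ r) within)) finite-a

    finite-step : ∀ m b → FiniteUpTo m (prev m b) → FiniteUpTo (suc m) (F m b)
    finite-step m b IH o _ _ = finite-Bool
    finite-step m b IH (a ⇒ r) ini within with regime m (a ⇒ r) within | W-or-not a
    ... | clause-i within′ | _ =
      subst FinitePER (sym (F-clause-i m b a r ini within′)) (IH (a ⇒ r) ini within′)
    ... | clause-ii ord _ | inj₁ refl = finite-W⇒-clause-ii m b r ini ord IH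
    ... | clause-ii ord act | inj₂ a≢W =
      finite-⇒ m b a r a≢W ini within (F-clause-ii m b a r a≢W ini act ord) (finite-step m b IH a)
        (finite-step m b IH r (proj₂ (initial-⇒ a r ini)) (inj₁ (s≤s (≤-trans (order-cod≤ a r) (≤-reflexive ord)))))
    ... | clause-iii ord inactive | _ =
      finite-⇒ m b a r a≢W ini within (F-clause-iii m b a r a≢W ini ord) (finite-step m b IH a)
        (finite-step m b IH r (proj₂ (initial-⇒ a r ini))
          (within-inactive r (≤-trans (order-cod≤ a r) (≤-reflexive ord)) (proj₂ (inactive-⇒ a r inactive))))
      where
      a≢W : isW a ≡ false
      a≢W = proj₁ (inactive-⇒ a r inactive)

    mutual
      finite : ∀ m b → FiniteUpTo (suc m) (F m b)
      finite m b = finite-step m b (finite-prev m b)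

      finite-prev : ∀ m b → FiniteUpTo m (prev m b)
      finite-prev zero _ o _ _ = finite-Bool
      finite-prev zero _ (a ⇒ r) _ (inj₂ (ord , _)) = contradiction ord (<⇒≢ (order-⇒-pos a r) ∘ sym)
      finite-prev (suc j) (b , _) = finite j b

lemma3p5 : ExcludedMiddle 0ℓ → (𝒜 : Setting) (fam : Construction.Family 𝒜)
    (σ : Ty) (n : ℕ) → Initial σ → 1 ≤ n →
    (order σ < n ⊎ (order σ ≡ n × Inactive σ)) →
    FinitePER (Construction.H 𝒜 fam n σ)
lemma3p5 em 𝒜 fam σ (suc m) ini _ within = finite 𝒜 em m (Construction.Family.B fam m) σ ini within
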